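{- For every atomic system $S$ and every $p\in\mathsf{At}_\bot$, $p^i \Vdash^L_S p^c$.
   Context: Basic setting. Let $\mathsf{At}$ be a countably infinite set of atomic propositions and $\mathsf{At}_\bot=\mathsf{At}\cup\{\bot\}$. An atomic rule has the form "from premises $p_1,\dots,p_n$ ($n\ge 0$) infer $p$", with $p_j,p\in\mathsf{At}_\bot$, where the derivation of each premise may discharge a set of basic sentences. An atomic system $S$ is a set of atomic rules; $S\subseteq S'$ ($S'$ extends $S$) if $S'$ contains all rules of $S$. $\Delta\vdash_S p$ means there is a natural-deduction derivation using only rules of $S$ with conclusion $p$ and undischarged assumptions in $\Delta$ (so $p\vdash_S p$). $S$ is consistent if $\nvdash_S\bot$. Standing convention: all atomic systems (including all extensions quantified over) are required to be consistent. Ecumenical formulas: $p^i,p^c$ for $p\in\mathsf{At}_\bot$; $(A\wedge B)^x,(A\vee B)^x,(A\to B)^x$ for $x\in\{i,c\}$. $A\wedge B$, $A\vee B$, $A\to B$ abbreviate the $i$-versions, $\bot$ denotes $\bot^i$, $\neg A:=(A\to\bot^i)^i$; for $X^c$, $X^i$ is the same construction with outer superscript $i$. Weak validity (by simultaneous recursion): (1) $\Vdash^L_S p^i$ iff $\vdash_S p$ ($p\in\mathsf{At}_\bot$); (2) $\Vdash^L_S p^c$ iff $p\nvdash_S\bot$; (3) for non-atomic $X$, $\Vdash^L_S X^c$ iff $X^i\nVdash^L_S\bot$; (4) $\Vdash^L_S(A\wedge B)^i$ iff $\Vdash^L_S A$ and $\Vdash^L_S B$; (5) $\Vdash^L_S(A\to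 B)^i$ iff $A\Vdash^G_S B$; (6) $\Vdash^L_S(A\vee B)^i$ iff for all $S'\supseteq S$ and all $p\in\mathsf{At}_\bot$, if $A\Vdash^L_{S'}p^i$ and $B\Vdash^L_{S'}p^i$ then $\Vdash^L_{S'}p^i$; (7) for nonempty $\Gamma$, $\Gamma\Vdash^L_S A$ iff for all $S'\supseteq S$, if $\Vdash^L_{S'}B$ for all $B\in\Gamma$ then $\Vdash^L_{S'}A$; (8) $\Gamma\Vdash^G_S A$ iff for all $S'\supseteq S$: if $\Vdash^L_{S''}B$ for all $B\in\Gamma$ and all $S''\supseteq S'$, then $\Vdash^L_{S''}A$ for all $S''\supseteq S'$; (9) $\Gamma\Vdash A$ iff $\Gamma\Vdash^G_S A$ for all $S$. -}

module Defs where

open import Level using (Level; 0ℓ) renaming (suc to lsuc)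
open import Data.Nat using (ℕ)
open import Data.List using (List; []; _∷_)
open import Data.List.Membership.Propositional using (_∈_)
open import Data.List.Relation.Unary.All using (All)
open import Data.Product using (_×_; proj₁; proj₂)
open import Data.Sum using (_⊎_)
open import Data.Empty using (⊥)
open import Data.Unit using (⊤)
open import Relation.Nullary using (¬_)
open import Relation.Binary.PropositionalEquality using (_≡_)

-- Basic sentences: At_⊥ = At ∪ {⊥}, with At = ℕ (countably infinite)

data AtB : Set where
  atom : ℕ → AtB
  bot  : AtB

record Rule : Set where
  constructor mkRule
  field
    premises   : List (List AtB × AtB)   -- (discharged set, premise)
    conclusion : AtB
open Rule public

System : Set₁
System = Rule → Set

_⊆S_ : System → System → Set
S ⊆S S' = ∀ r → S r → S' r

Ctx : Set₁
Ctx = AtB → Set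

∅ : Ctx
∅ _ = ⊥

⟨_⟩ : AtB → Ctx
⟨ p ⟩ q = q ≡ p

_∪L_ : Ctx → List AtB → Ctx
(Δ ∪L Γ) q = Δ q ⊎ q ∈ Γ

data _⊢[_]_ (Δ : Ctx) (S : System) : AtB → Set where
  ass  : ∀ {p} → Δ p → Δ ⊢[ S ] p
  rule : ∀ r → S r →
         All (λ prem → (Δ ∪L proj₁ prem) ⊢[ S ] proj₂ prem) (premises r) →
         Δ ⊢[ S ] conclusion r

Consistent : System → Set
Consistent S = ¬ (∅ ⊢[ S ] bot)

data Tag : Set where
  i c : Tag

data Op : Set where
  ∧' ∨' →' : Op

data Form : Set where
  at  : AtB → Tag → Form
  bin : Op → Form → Form → Tag → Form

⊥ⁱ : Form
⊥ⁱ = at bot i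

-- Weak validity.  All quantified extensions are required consistent.

data Lift1 (X : Set) : Set₁ where
  lift1 : X → Lift1 X

mutual
  ⊩L : System → Form → Set₁
  ⊩L S (at p i) = Lift1 (∅ ⊢[ S ] p)
  ⊩L S (at p c) = Lift1 (¬ (⟨ p ⟩ ⊢[ S ] bot))
  ⊩L S (bin o A B i) = ⊩Li S o A B
  ⊩L S (bin o A B c) =                                         -- (3): ¬ ( X^i ⊩^L_S ⊥^i ), unfolded by (7),(1)
    ¬ (∀ S' → S ⊆S S' → Consistent S' → ⊩Li S' o A B → Lift1 (∅ ⊢[ S' ] bot))

  ⊩Li : System → Op → Form → Form → Set₁
  ⊩Li S ∧' A B = ⊩L S A × ⊩L S B
  ⊩Li S →' A B = ⊩G1 S A B
  ⊩Li S ∨' A B =                                               -- (6), with A ⊩^L_{S'} p^i unfolded by (7),(1)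
    ∀ S' → S ⊆S S' → Consistent S' → ∀ (p : AtB) →
      (∀ S'' → S' ⊆S S'' → Consistent S'' → ⊩L S'' A → Lift1 (∅ ⊢[ S'' ] p)) →
      (∀ S'' → S' ⊆S S'' → Consistent S'' → ⊩L S'' B → Lift1 (∅ ⊢[ S'' ] p)) →
      Lift1 (∅ ⊢[ S' ] p)

  -- {A} ⊩^G_S B  (clause (8) for a singleton Γ)
  ⊩G1 : System → Form → Form → Set₁
  ⊩G1 S A B = ∀ S' → S ⊆S S' → Consistent S' →
    (∀ S'' → S' ⊆S S'' → Consistent S'' → ⊩L S'' A) →
    (∀ S'' → S' ⊆S S'' → Consistent S'' → ⊩L S'' B)

-- Γ ⊩^L_S A  (clause (7), for nonempty Γ given as a list)
AllF : System → List Form → Set₁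
AllF S [] = Lift1 ⊤
AllF S (B ∷ Γ) = ⊩L S B × AllF S Γ

⊩Lc : System → List Form → Form → Set₁
⊩Lc S Γ A = ∀ S' → S ⊆S S' → Consistent S' → AllF S' Γ → ⊩L S' A

-- Atomic derivability is closed under cut, so from ⊢ p and p ⊢ ⊥ in an extension we
-- would get ⊢ ⊥ there, contradicting its consistency.

module Submission where

open import Defs
open import Data.List using (List; []; _∷_)
open import Data.List.Relation.Unary.All using (All; []; _∷_)
open import Data.Product using (_×_; _,_; proj₁; proj₂)
open import Data.Sum using (inj₁; inj₂; map₁)
open import Relation.Binary.PropositionalEquality using (refl)

Premises : Ctx → System → List (List AtB × AtB) → Set
Premises Δ S = All (λ prem → (Δ ∪L proj₁ prem) ⊢[ S ] proj₂ prem)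

mutual
  ⊢-weaken : ∀ {S Δ Γ p} → (∀ q → Δ q → Γ q) → Δ ⊢[ S ] p → Γ ⊢[ S ] p
  ⊢-weaken f (ass x)         = ass (f _ x)
  ⊢-weaken f (rule r r∈S ds) = rule r r∈S (premises-weaken f ds)

  premises-weaken : ∀ {S Δ Γ ps} → (∀ q → Δ q → Γ q) → Premises Δ S ps → Premises Γ S ps
  premises-weaken f []       = []
  premises-weaken f (d ∷ ds) = ⊢-weaken (λ q → map₁ (f q)) d ∷ premises-weaken f ds

substitution-∪L : ∀ {S Δ Γ Θ} → (∀ q → Δ q → Γ ⊢[ S ] q) → ∀ q → (Δ ∪L Θ) q → (Γ ∪L Θ) ⊢[ S ] q
substitution-∪L σ q (inj₁ x) = ⊢-weaken (λ _ → inj₁) (σ q x)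
substitution-∪L σ q (inj₂ y) = ass (inj₂ y)

mutual
  ⊢-subst : ∀ {S Δ Γ p} → (∀ q → Δ q → Γ ⊢[ S ] q) → Δ ⊢[ S ] p → Γ ⊢[ S ] p
  ⊢-subst σ (ass x)         = σ _ x
  ⊢-subst σ (rule r r∈S ds) = rule r r∈S (premises-subst σ ds)

  premises-subst : ∀ {S Δ Γ ps} → (∀ q → Δ q → Γ ⊢[ S ] q) → Premises Δ S ps → Premises Γ S ps
  premises-subst σ []       = []
  premises-subst σ (d ∷ ds) = ⊢-subst (substitution-∪L σ) d ∷ premises-subst σ ds

⊢-cut : ∀ {S Δ p q} → Δ ⊢[ S ] p → ⟨ p ⟩ ⊢[ S ] q → Δ ⊢[ S ] q
⊢-cut d e = ⊢-subst (λ { _ refl → d }) e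

theorem1 : (S : System) → Consistent S → (p : AtB) →
    ⊩Lc S (at p i ∷ []) (at p c)
theorem1 S _ p S' _ consistent (lift1 ⊢p , _) =
  lift1 (λ p⊢⊥ → consistent (⊢-cut ⊢p p⊢⊥))
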